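{- Let $(\Phi,\mathcal T,d,\downarrow,\otimes,\le)$ be an adjoint information algebra over a topological space $(X,\mathcal T)$ with $X$ finite, let $K=\{\phi_1,\dots,\phi_n\}\subseteq\Phi$ be a finite set of valuations, and let $\gamma=\phi_1\otimes\cdots\otimes\phi_n$. Then $K$ agrees globally if and only if $\gamma^{\downarrow d\phi_i}=\phi_i$ for all $1\le i\le n$. In this case $\gamma$ is the greatest truth valuation for $K$, i.e. $\gamma$ is a truth valuation for $K$ and $\delta\le\gamma$ for every truth valuation $\delta$ for $K$.
   Context: An information algebra over $(X,\mathcal T)$ is a quintuple $(\Phi,\mathcal T,d,\downarrow,\otimes)$: a set $\Phi$ (valuations), a labelling $d:\Phi\to\mathcal T$, a projection $(\phi,U)\mapsto\phi^{\downarrow U}$ defined when $U\subseteq d\phi$, and a binary combination $\otimes$ on $\Phi$, with $\Phi_U\defeq\{\phi:d\phi=U\}$, satisfying: (I1) $\otimes$ is associative and commutative; (I2) $d(\phi^{\downarrow U})=U$; (I3) $(\phi^{\downarrow U})^{\downarrow W}=\phi^{\downarrow W}$ for $W\subseteq U\subseteq d\phi$; (I4) $\phi^{\downarrow d\phi}=\phi$; (I5) $d(\phi\otimes\psi)=d\phi\cup d\psi$; (I6) if $U=d\phi$, $W=d\psi$ and $Q\in\mathcal T$ with $U\subseteq Q\subseteq U\cup W$, then $(\phi\otimes\psi)^{\downarrow Q}=\phi\otimes\psi^{\downarrow Q\cap W}$; (I7) for each $U$ there is $1_U\in\Phi_U$ with $\phi\otimes 1_U=1_U\otimes\phi=\phi$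 for $\phi\in\Phi_U$, and $1_U\otimes 1_W=1_{U\cup W}$; (I8) for each $U$ there is $0_U\in\Phi_U$ with $\phi\otimes 0_U=0_U\otimes\phi=0_U$, and for $W\subseteq U$, $\phi\in\Phi_U$: $\phi^{\downarrow W}=0_W\iff\phi=0_U$; (I9) $\phi\otimes\phi^{\downarrow U}=\phi$ for $U\subseteq d\phi$. It is ordered if $\le$ is a partial order on $\Phi$ with: (O1) $\phi\le\psi$ implies $d\phi=d\psi$, and every subset of each $\Phi_U$ has an infimum; (O2) $\inf\Phi_U=0_U$; (O3) $\phi_1\le\phi_2$, $\psi_1\le\psi_2$ imply $\phi_1\otimes\psi_1\le\phi_2\otimes\psi_2$; (O4) $\phi\le\psi$ implies $\phi^{\downarrow U}\le\psi^{\downarrow U}$. It is adjoint if moreover for all $U,W\in\mathcal T$: $\phi\le\phi^{\downarrow U}\otimes\phi^{\downarrow W}$ for all $\phi\in\Phi_{U\cup W}$, and $(\phi\otimes\psi)^{\downarrow U}\le\phi$, $(\phi\otimes\psi)^{\downarrow W}\le\psi$ for all $\phi\in\Phi_U$, $\psi\in\Phi_W$ (i.e. $\otimes:\Phi_U\times\Phi_W\to\Phi_{U\cup W}$ is right adjoint to $\phi\mapsto(\phi^{\downarrow U},\phi^{\downarrow W})$). A truth valuation for $K=\{\phi_1,\dots,\phi_n\}$ is some $\delta\in\Phi_{U}$ with $U=\bigcup_i d\phi_i$ and $\delta^{\downarrow d\phi_i}=\phi_i$ for all $i$; $K$ agrees globally iff a truth valuation for $K$ exists. -}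

module Defs where

open import Data.Nat using (ℕ; zero; suc)
open import Data.Fin using (Fin; zero; suc)
open import Data.Fin.Subset using (Subset; _∪_; _∩_; _⊆_) renaming (⊥ to ∅; ⊤ to Full)
open import Data.Fin.Subset.Properties using (⊆-refl; ⊆-trans; p⊆p∪q; q⊆p∪q; p∩q⊆q)
open import Data.Product using (Σ; _×_; _,_)
open import Function using (_∘_)
open import Function.Bundles using (_⇔_)
open import Relation.Binary.PropositionalEquality using (_≡_; refl; sym; trans; subst; cong)
open import Relation.Binary.Structures using (IsPartialOrder)

-- A topology on the finite set X = Fin m: a family of open subsets containing
-- ∅ and X, closed under binary unions and intersections (for finite X this is
-- the same as closure under arbitrary unions and finite intersections).
record FiniteTopology (m : ℕ) : Set₁ where
  field
    Open     : Subset m → Set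
    ∅-open   : Open ∅
    X-open   : Open Full
    ∪-open   : ∀ {U W} → Open U → Open W → Open (U ∪ W)
    ∩-open   : ∀ {U W} → Open U → Open W → Open (U ∩ W)

-- Labels are the open sets; the projection φ ↓ U is defined for open U ⊆ d φ
-- (the proofs of openness and inclusion are irrelevant arguments).
record AdjointInformationAlgebra {m : ℕ} (T : FiniteTopology m) : Set₁ where
  open FiniteTopology T
  infixl 7 _⊗_
  infix 4 _≤_
  field
    Φ      : Set
    d      : Φ → Subset m
    d-open : ∀ φ → Open (d φ)
    proj   : (φ : Φ) (U : Subset m) → .(Open U) → .(U ⊆ d φ) → Φ
    _⊗_    : Φ → Φ → Φ
    ⊗-assoc : ∀ φ ψ χ → (φ ⊗ ψ) ⊗ χ ≡ φ ⊗ (ψ ⊗ χ)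
    ⊗-comm  : ∀ φ ψ → φ ⊗ ψ ≡ ψ ⊗ φ
    d-proj  : ∀ φ U .(oU : Open U) .(s : U ⊆ d φ) → d (proj φ U oU s) ≡ U
    proj-proj : ∀ φ U W .(oU : Open U) .(oW : Open W) (W⊆U : W ⊆ U) (U⊆d : U ⊆ d φ) →
      proj (proj φ U oU U⊆d) W oW (subst (W ⊆_) (sym (d-proj φ U oU U⊆d)) W⊆U)
        ≡ proj φ W oW (⊆-trans W⊆U U⊆d)
    proj-d  : ∀ φ → proj φ (d φ) (d-open φ) ⊆-refl ≡ φ
    d-⊗     : ∀ φ ψ → d (φ ⊗ ψ) ≡ d φ ∪ d ψ
    combination : ∀ φ ψ Q .(oQ : Open Q) → d φ ⊆ Q → (Q⊆ : Q ⊆ d φ ∪ d ψ) →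
      proj (φ ⊗ ψ) Q oQ (subst (Q ⊆_) (sym (d-⊗ φ ψ)) Q⊆)
        ≡ φ ⊗ proj ψ (Q ∩ d ψ) (∩-open oQ (d-open ψ)) (p∩q⊆q Q (d ψ))
    𝟙       : (U : Subset m) → .(Open U) → Φ
    d-𝟙     : ∀ U .(oU : Open U) → d (𝟙 U oU) ≡ U
    𝟙-unitʳ : ∀ φ U .(oU : Open U) → d φ ≡ U → φ ⊗ 𝟙 U oU ≡ φ
    𝟙-unitˡ : ∀ φ U .(oU : Open U) → d φ ≡ U → 𝟙 U oU ⊗ φ ≡ φ
    𝟙-⊗     : ∀ U W .(oU : Open U) .(oW : Open W) → 𝟙 U oU ⊗ 𝟙 W oW ≡ 𝟙 (U ∪ W) (∪-open oU oW)
    𝟘       : (U : Subset m) → .(Open U) → Φ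
    d-𝟘     : ∀ U .(oU : Open U) → d (𝟘 U oU) ≡ U
    𝟘-nullʳ : ∀ φ U .(oU : Open U) → d φ ≡ U → φ ⊗ 𝟘 U oU ≡ 𝟘 U oU
    𝟘-nullˡ : ∀ φ U .(oU : Open U) → d φ ≡ U → 𝟘 U oU ⊗ φ ≡ 𝟘 U oU
    𝟘-proj  : ∀ φ W .(oW : Open W) (W⊆ : W ⊆ d φ) →
      (proj φ W oW W⊆ ≡ 𝟘 W oW) ⇔ (φ ≡ 𝟘 (d φ) (d-open φ))
    idempotence : ∀ φ U .(oU : Open U) .(s : U ⊆ d φ) → φ ⊗ proj φ U oU s ≡ φ
    _≤_          : Φ → Φ → Set
    ≤-isPartialOrder : IsPartialOrder _≡_ _≤_
    ≤-d          : ∀ {φ ψ} → φ ≤ ψ → d φ ≡ d ψ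
    infimum      : ∀ U → Open U → (P : Φ → Set) → (∀ φ → P φ → d φ ≡ U) →
      Σ Φ λ i → d i ≡ U × (∀ φ → P φ → i ≤ φ)
                        × (∀ j → d j ≡ U → (∀ φ → P φ → j ≤ φ) → j ≤ i)
    𝟘-least      : ∀ U .(oU : Open U) φ → d φ ≡ U → 𝟘 U oU ≤ φ
    ⊗-mono       : ∀ {φ₁ φ₂ ψ₁ ψ₂} → φ₁ ≤ φ₂ → ψ₁ ≤ ψ₂ → φ₁ ⊗ ψ₁ ≤ φ₂ ⊗ ψ₂
    proj-mono    : ∀ φ ψ U .(oU : Open U) .(s : U ⊆ d φ) .(t : U ⊆ d ψ) →
      φ ≤ ψ → proj φ U oU s ≤ proj ψ U oU t
    adj-unit     : ∀ U W .(oU : Open U) .(oW : Open W) φ (e : d φ ≡ U ∪ W) →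
      φ ≤ proj φ U oU (subst (U ⊆_) (sym e) (p⊆p∪q W))
            ⊗ proj φ W oW (subst (W ⊆_) (sym e) (q⊆p∪q U W))
    adj-counitˡ  : ∀ φ ψ →
      proj (φ ⊗ ψ) (d φ) (d-open φ) (subst (d φ ⊆_) (sym (d-⊗ φ ψ)) (p⊆p∪q (d ψ))) ≤ φ
    adj-counitʳ  : ∀ φ ψ →
      proj (φ ⊗ ψ) (d ψ) (d-open ψ) (subst (d ψ ⊆_) (sym (d-⊗ φ ψ)) (q⊆p∪q (d φ) (d ψ))) ≤ ψ

module Knowledgebase {m : ℕ} {T : FiniteTopology m} (A : AdjointInformationAlgebra T) where
  open FiniteTopology T
  open AdjointInformationAlgebra A

  ⋃d : ∀ {k} → (Fin (suc k) → Φ) → Subset m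
  ⋃d {zero}  φs = d (φs zero)
  ⋃d {suc k} φs = d (φs zero) ∪ ⋃d (φs ∘ suc)

  ⊗* : ∀ {k} → (Fin (suc k) → Φ) → Φ
  ⊗* {zero}  φs = φs zero
  ⊗* {suc k} φs = φs zero ⊗ ⊗* (φs ∘ suc)

  d⊆⋃d : ∀ {k} (φs : Fin (suc k) → Φ) (i : Fin (suc k)) → d (φs i) ⊆ ⋃d φs
  d⊆⋃d {zero}  φs zero    = ⊆-refl
  d⊆⋃d {suc k} φs zero    = p⊆p∪q (⋃d (φs ∘ suc))
  d⊆⋃d {suc k} φs (suc i) = ⊆-trans (d⊆⋃d (φs ∘ suc) i) (q⊆p∪q (d (φs zero)) (⋃d (φs ∘ suc)))

  d-⊗* : ∀ {k} (φs : Fin (suc k) → Φ) → d (⊗* φs) ≡ ⋃d φs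
  d-⊗* {zero}  φs = refl
  d-⊗* {suc k} φs = trans (d-⊗ (φs zero) (⊗* (φs ∘ suc))) (cong (d (φs zero) ∪_) (d-⊗* (φs ∘ suc)))

  IsTruthValuation : ∀ {k} → (Fin (suc k) → Φ) → Φ → Set
  IsTruthValuation φs δ =
    Σ (d δ ≡ ⋃d φs) λ e →
      ∀ i → proj δ (d (φs i)) (d-open (φs i)) (subst (d (φs i) ⊆_) (sym e) (d⊆⋃d φs i)) ≡ φs i

  AgreesGlobally : ∀ {k} → (Fin (suc k) → Φ) → Set
  AgreesGlobally φs = Σ Φ (IsTruthValuation φs)

  CombinationProjects : ∀ {k} → (Fin (suc k) → Φ) → Set
  CombinationProjects φs =
    ∀ i → proj (⊗* φs) (d (φs i)) (d-open (φs i))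
                 (subst (d (φs i) ⊆_) (sym (d-⊗* φs)) (d⊆⋃d φs i)) ≡ φs i

{-# OPTIONS --safe #-}
-- The unit of the adjunction, δ ≤ δ↓U ⊗ δ↓W, applied along φ₁ ⊗ (φ₂ ⊗ …), shows
-- that every truth valuation δ lies below γ = φ₁ ⊗ … ⊗ φₙ; the counit shows
-- γ↓dφᵢ ≤ φᵢ. If K agrees globally with truth valuation δ, then monotonicity of
-- projection gives φᵢ = δ↓dφᵢ ≤ γ↓dφᵢ ≤ φᵢ, so γ itself is a truth valuation.
module Submission where

open import Defs
open import Data.Nat using (ℕ; suc; zero)
open import Data.Fin using (Fin; zero; suc)
open import Data.Product using (_×_; _,_; proj₁; proj₂)
open import Function.Bundles using (_⇔_; mk⇔)
open import Function using (_∘_)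
open import Data.Fin.Subset using (_⊆_)
open import Data.Fin.Subset.Properties using (⊆-refl; q⊆p∪q)
open import Relation.Binary.PropositionalEquality using (_≡_; refl; sym; trans; subst; cong; module ≡-Reasoning)
open import Relation.Binary.Structures using (IsPartialOrder)

module TruthValuations {m : ℕ} {T : FiniteTopology m} (A : AdjointInformationAlgebra T) where
  open FiniteTopology T
  open AdjointInformationAlgebra A
  open Knowledgebase A
  open IsPartialOrder ≤-isPartialOrder using (reflexive; antisym) renaming (refl to ≤-refl; trans to ≤-trans)

  proj-cong : ∀ φ {U V} → U ≡ V → .(oU : Open U) .(oV : Open V) .(s : U ⊆ d φ) .(t : V ⊆ d φ) →
    proj φ U oU s ≡ proj φ V oV t
  proj-cong φ refl oU oV s t = refl

  ⋃d-open : ∀ {k} (φs : Fin (suc k) → Φ) → Open (⋃d φs)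
  ⋃d-open φs = subst Open (d-⊗* φs) (d-open (⊗* φs))

  truthValuation-singleton : (φs : Fin 1 → Φ) (δ : Φ) → IsTruthValuation φs δ → δ ≡ φs zero
  truthValuation-singleton φs δ (e , δ↓≡) = begin
    δ                                                ≡⟨ sym (proj-d δ) ⟩
    proj δ (d δ) (d-open δ) ⊆-refl                   ≡⟨ proj-cong δ e _ (d-open (φs zero)) _ _ ⟩
    proj δ (d (φs zero)) (d-open (φs zero)) _        ≡⟨ δ↓≡ zero ⟩
    φs zero                                          ∎
    where open ≡-Reasoning

  module _ {k : ℕ} (φs : Fin (suc (suc k)) → Φ) (δ : Φ) (tv : IsTruthValuation φs δ) where
    private
      e = proj₁ tv
      W = ⋃d (φs ∘ suc)
      W⊆dδ : W ⊆ d δ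
      W⊆dδ = subst (W ⊆_) (sym e) (q⊆p∪q (d (φs zero)) W)

    proj-tail : Φ
    proj-tail = proj δ W (⋃d-open (φs ∘ suc)) W⊆dδ

    truthValuation-proj-tail : IsTruthValuation (φs ∘ suc) proj-tail
    truthValuation-proj-tail =
        d-proj δ W (⋃d-open (φs ∘ suc)) W⊆dδ
      , λ i → trans (proj-proj δ W _ _ (d-open (φs (suc i))) (d⊆⋃d (φs ∘ suc) i) W⊆dδ)
                    (proj₂ tv (suc i))

    truthValuation-≤-head⊗proj-tail : δ ≤ φs zero ⊗ proj-tail
    truthValuation-≤-head⊗proj-tail =
      ≤-trans (adj-unit (d (φs zero)) W (d-open (φs zero)) (⋃d-open (φs ∘ suc)) δ e)
              (reflexive (cong (_⊗ proj-tail) (proj₂ tv zero)))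

  truthValuation-≤-⊗* : ∀ {k} (φs : Fin (suc k) → Φ) (δ : Φ) → IsTruthValuation φs δ → δ ≤ ⊗* φs
  truthValuation-≤-⊗* {zero}  φs δ tv = reflexive (truthValuation-singleton φs δ tv)
  truthValuation-≤-⊗* {suc k} φs δ tv =
    ≤-trans (truthValuation-≤-head⊗proj-tail φs δ tv)
            (⊗-mono ≤-refl (truthValuation-≤-⊗* (φs ∘ suc) (proj-tail φs δ tv)
                                                 (truthValuation-proj-tail φs δ tv)))

  proj-⊗*-≤ : ∀ {k} (φs : Fin (suc k) → Φ) (i : Fin (suc k)) →
    proj (⊗* φs) (d (φs i)) (d-open (φs i)) (subst (d (φs i) ⊆_) (sym (d-⊗* φs)) (d⊆⋃d φs i))
      ≤ φs i
  proj-⊗*-≤ {zero}  φs zero    = reflexive (proj-d (φs zero))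
  proj-⊗*-≤ {suc k} φs zero    = adj-counitˡ (φs zero) (⊗* (φs ∘ suc))
  proj-⊗*-≤ {suc k} φs (suc j) =
    ≤-trans (reflexive (sym (proj-proj (⊗* φs) (d ψ) V (d-open ψ) (d-open (φs (suc j))) V⊆dψ dψ⊆)))
            (≤-trans (proj-mono _ ψ V (d-open (φs (suc j))) _ V⊆dψ (adj-counitʳ (φs zero) ψ))
                     (proj-⊗*-≤ (φs ∘ suc) j))
    where
      ψ = ⊗* (φs ∘ suc)
      V = d (φs (suc j))
      V⊆dψ : V ⊆ d ψ
      V⊆dψ = subst (V ⊆_) (sym (d-⊗* (φs ∘ suc))) (d⊆⋃d (φs ∘ suc) j)
      dψ⊆ : d ψ ⊆ d (⊗* φs)
      dψ⊆ = subst (d ψ ⊆_) (sym (d-⊗ (φs zero) ψ)) (q⊆p∪q (d (φs zero)) (d ψ))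

  agreesGlobally⇒combinationProjects : ∀ {k} (φs : Fin (suc k) → Φ) →
    AgreesGlobally φs → CombinationProjects φs
  agreesGlobally⇒combinationProjects φs (δ , tv@(_ , δ↓≡)) i =
    antisym (proj-⊗*-≤ φs i)
            (≤-trans (reflexive (sym (δ↓≡ i)))
                     (proj-mono δ (⊗* φs) (d (φs i)) (d-open (φs i)) _ _ (truthValuation-≤-⊗* φs δ tv)))

theorem6 : (m : ℕ) (T : FiniteTopology m) (A : AdjointInformationAlgebra T)
    (k : ℕ) (φs : Fin (suc k) → AdjointInformationAlgebra.Φ A) →
    let open Knowledgebase A in
    let open AdjointInformationAlgebra A in
    (AgreesGlobally φs ⇔ CombinationProjects φs)
      × (AgreesGlobally φs →
          IsTruthValuation φs (⊗* φs)
            × (∀ δ → IsTruthValuation φs δ → δ ≤ ⊗* φs))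
theorem6 m T A k φs =
    mk⇔ (agreesGlobally⇒combinationProjects φs) (λ γ↓≡ → ⊗* φs , d-⊗* φs , γ↓≡)
  , λ agrees → (d-⊗* φs , agreesGlobally⇒combinationProjects φs agrees) , truthValuation-≤-⊗* φs
  where
    open Knowledgebase A
    open TruthValuations A
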